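{- Let $M=p_1^{n_1}\cdots p_K^{n_K}$, fix $i\in\{1,\dots,K\}$ and $0\le\alpha<n_i$, and let $A,B\subset\mathbb{Z}_M$ with $A\oplus B=\mathbb{Z}_M$. Let $z_0,z_1,\dots,z_{p_i-1}\in\mathbb{Z}_M$ satisfy $(z_\nu-z_{\nu'},M)=M/p_i^{\alpha+1}$ for $\nu\ne\nu'$, and let $a_\nu\in A,b_\nu\in B$ with $a_\nu+b_\nu=z_\nu$. Then one of the following holds: (i) $a_1,\dots,a_{p_i-1}\in\Pi(a_0,p_i^{n_i-\alpha})$ and $p_i^{n_i-\alpha-1}\parallel b_\nu-b_{\nu'}$ for all $\nu\ne\nu'$; (ii) $b_1,\dots,b_{p_i-1}\in\Pi(b_0,p_i^{n_i-\alpha})$ and $p_i^{n_i-\alpha-1}\parallel a_\nu-a_{\nu'}$ for all $\nu\ne\nu'$.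
   Context: $A\oplus B=\mathbb{Z}_M$: every element of $\mathbb{Z}_M$ is uniquely $a+b$. For $x\in\mathbb{Z}_M$ and $m\mid M$, $(x,m)$ is the gcd of $m$ with a representative of $x$. $\Pi(x,p^\beta)=\{x'\in\mathbb{Z}_M:p^\beta\mid x-x'\}$. $p^\beta\parallel x$ means $p^\beta\mid x$ and $p^{\beta+1}\nmid (x,M)$. -}

module Defs where

open import Data.Nat using (ℕ; suc; _+_; _*_; _∸_; _^_; NonZero)
open import Data.Nat.DivMod using (_%_)
open import Data.Nat.Divisibility using (_∣_)
open import Data.Nat.GCD using (gcd)
open import Data.Fin using (Fin; toℕ)
open import Data.Product using (Σ; _×_)
open import Relation.Binary.PropositionalEquality using (_≡_)
open import Relation.Nullary using (¬_)

-- A representative (in ℕ) of x - y ∈ ℤ_M.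
diff : {M : ℕ} → Fin M → Fin M → ℕ
diff {M} x y = toℕ x + (M ∸ toℕ y)

addM : (M : ℕ) .{{_ : NonZero M}} → Fin M → Fin M → ℕ
addM M a b = (toℕ a + toℕ b) % M

record DirectSum (M : ℕ) .{{_ : NonZero M}} (A B : Fin M → Set) : Set where
  field
    cover  : ∀ (x : Fin M) → Σ (Fin M) λ a → Σ (Fin M) λ b →
               A a × B b × addM M a b ≡ toℕ x
    unique : ∀ (a b a' b' : Fin M) → A a → B b → A a' → B b' →
               addM M a b ≡ addM M a' b' → (a ≡ a') × (b ≡ b')

gcdM : (M : ℕ) → ℕ → ℕ
gcdM M x = gcd x M

-- x' ∈ Π(x, q)  iff  q ∣ x - x'   (used with q = p^β, p^β ∣ M).
_∈Π[_,_] : {M : ℕ} → Fin M → Fin M → ℕ → Set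
x' ∈Π[ x , q ] = q ∣ diff x x'

Exact : (M p β x : ℕ) → Set
Exact M p β x = (p ^ β ∣ x) × ¬ (p ^ suc β ∣ gcdM M x)

module Submission where

-- Write M = N p^n with p ∤ N and put k = n − α − 1. For ν ≠ ν' the gcd condition says that N p^k
-- divides z_ν − z_ν' = (a_ν − a_ν') + (b_ν − b_ν') while p^(k+1) does not, so p^(k+1) divides at
-- most one of the two differences. It divides at least one: otherwise both differences have the
-- same exact power p^j (j ≤ k), and there is a t coprime to M with t (a_ν − a_ν') + (b_ν − b_ν') ≡ 0,
-- contradicting Tijdeman's theorem that t A ⊕ B = ℤ_M. (Tijdeman's theorem is proved with mask
-- polynomials, from the congruence A(X)^q ≡ A(X^q) mod q.) Finally "p^(k+1) divides a_ν − a_ν'"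
-- and "p^(k+1) divides b_ν − b_ν'" are equivalence relations splitting the pairs of indices, and
-- two such relations on p ≥ 2 indices force one of them to relate all indices to 0.

open import Defs
open import Data.Nat using (ℕ; zero; suc; _+_; _*_; _∸_; _^_; _<_; NonZero)
open import Data.Nat.Divisibility using (_∣_)
open import Data.Nat.Primality using (Prime)
open import Data.Fin using (Fin; toℕ)
open import Data.Product using (_×_)
open import Data.Sum using (_⊎_)
open import Relation.Binary.PropositionalEquality using (_≡_; _≢_)
open import Relation.Nullary using (¬_)

open import Level using (0ℓ)
open import Function using (id; _∘_; _on_; case_of_)
open import Data.Empty using (⊥; ⊥-elim)
open import Data.Product using (∃; _,_; proj₁; proj₂)
open import Data.Sum using (inj₁; inj₂)
import Data.Sum as Sum
open import Data.List using ([]; _∷_)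
open import Data.List.Relation.Unary.All using (All; []; _∷_)
open import Data.Nat using (pred; _≤_; z≤n; s≤s; z<s; _!; 2+; nonTrivial⇒n>1; ≢-nonZero⁻¹)
open import Data.Nat.Properties
open import Data.Nat.Divisibility
open import Data.Nat.DivMod
open import Data.Nat.GCD using (gcd; gcd[m,n]∣m; gcd-greatest; module Bézout)
open import Data.Nat.Coprimality using (Coprime; coprime-Bézout)
open import Data.Nat.Primality
open import Data.Nat.Primality.Factorisation using (factorise; PrimeFactorisation)
open import Data.Nat.Combinatorics using (_C_; nCn≡1; nCk≡n!/k![n-k]!; k![n∸k]!∣n!)
open import Data.Nat.ListAction using (product)
open import Data.Nat.Tactic.RingSolver using (solve-∀)
import Data.Fin as Fin
import Data.Fin.Properties as Fin
open import Data.Fin using (fromℕ)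
open import Data.Fin.Permutation using (Permutation; permutation)
open import Relation.Nullary using (yes; no)
open import Relation.Binary.Core using (Rel)
open import Relation.Binary.Structures using (IsEquivalence)
import Relation.Binary.Construct.On as On
open import Relation.Binary.PropositionalEquality hiding ([_])
open import Algebra.Bundles using (CommutativeSemiring)
open import Algebra.Properties.Semiring.Sum +-*-semiring
  using (sum; sum-cong-≗; ∑-comm; ∑-permute; ∑-distrib-+; *-distribˡ-sum; *-distribʳ-sum; sum-replicate-zero)

private variable n p q : ℕ

-- Primes and divisibility

prime>1 : Prime q → 1 < q
prime>1 {q} pq = nonTrivial⇒n>1 q {{prime⇒nonTrivial pq}}

prime∤1 : Prime q → ¬ (q ∣ 1)
prime∤1 pq q∣1 = <⇒≢ (prime>1 pq) (sym (∣1⇒≡1 q∣1))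

prime∤! : Prime q → ∀ j → j < q → ¬ (q ∣ j !)
prime∤! pq zero    _   = prime∤1 pq
prime∤! pq (suc j) j<q q∣j! with euclidsLemma (suc j) (j !) pq q∣j!
... | inj₁ q∣1+j = <⇒≱ j<q (∣⇒≤ q∣1+j)
... | inj₂ q∣j!  = prime∤! pq j (<-trans (n<1+n j) j<q) q∣j!

prime∣C : ∀ {k} → Prime q → 0 < k → k < q → q ∣ q C k
prime∣C {q} {k} pq 0<k k<q = Sum.[ id , ⊥-elim ∘ q∤k!*[q∸k]! ] (euclidsLemma (q C k) (k ! * (q ∸ k) !) pq q∣C*k!*[q∸k]!)
  where
  q∤k!*[q∸k]! : ¬ (q ∣ k ! * (q ∸ k) !)
  q∤k!*[q∸k]! = Sum.[ prime∤! pq k k<q , prime∤! pq (q ∸ k) (∸-monoʳ-< 0<k (<⇒≤ k<q)) ]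
              ∘ euclidsLemma (k !) ((q ∸ k) !) pq
  instance _ = k !* (q ∸ k) !≢0
  q∣q! : q ∣ q !
  q∣q! = subst (λ r → r ∣ r !) (suc-pred q {{prime⇒nonZero pq}}) (m∣m*n (pred q !))
  q∣C*k!*[q∸k]! : q ∣ (q C k) * (k ! * (q ∸ k) !)
  q∣C*k!*[q∸k]! = subst (q ∣_) (sym (trans (cong (_* (k ! * (q ∸ k) !)) (nCk≡n!/k![n-k]! (<⇒≤ k<q)))
                                           (m/n*n≡m (k![n∸k]!∣n! (<⇒≤ k<q))))) q∣q!

prime∣^⇒∣ : ∀ {a} n → Prime q → q ∣ a ^ n → q ∣ a
prime∣^⇒∣     zero    pq q∣1 = ⊥-elim (prime∤1 pq q∣1)
prime∣^⇒∣ {a = a} (suc n) pq q∣a^1+n with euclidsLemma a (a ^ n) pq q∣a^1+n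
... | inj₁ q∣a   = q∣a
... | inj₂ q∣a^n = prime∣^⇒∣ n pq q∣a^n

prime∣prime^⇒≡ : ∀ n → Prime q → Prime p → q ∣ p ^ n → q ≡ p
prime∣prime^⇒≡ n pq pp q∣p^n with prime⇒irreducible pp (prime∣^⇒∣ n pq q∣p^n)
... | inj₁ q≡1 = ⊥-elim (<⇒≢ (prime>1 pq) (sym q≡1))
... | inj₂ q≡p = q≡p

∃prime∣ : ∀ {i} → 1 < i → ∃ λ r → Prime r × r ∣ i
∃prime∣ {i@(suc _)} 1<i = go (factors fac) (isFactorisation fac) (factorsPrime fac)
  where
  open PrimeFactorisation
  fac = factorise i
  go : ∀ rs → i ≡ product rs → All Prime rs → ∃ λ r → Prime r × r ∣ i
  go []       i≡1 _        = ⊥-elim (<⇒≢ 1<i (sym i≡1))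
  go (r ∷ rs) i≡  (pr ∷ _) = r , pr , subst (r ∣_) (sym i≡) (m∣m*n (product rs))

-- A common divisor 0 forces m = n = 0, which share the prime 2.
noCommonPrime⇒coprime : ∀ {m n} → (∀ r → Prime r → r ∣ m → ¬ (r ∣ n)) → Coprime m n
noCommonPrime⇒coprime noCommon {zero} (0∣m , 0∣n) =
  ⊥-elim (noCommon 2 prime[2] (subst (2 ∣_) (sym (0∣⇒≡0 0∣m)) (2 ∣0)) (subst (2 ∣_) (sym (0∣⇒≡0 0∣n)) (2 ∣0)))
noCommonPrime⇒coprime noCommon {1} _ = refl
noCommonPrime⇒coprime noCommon {i@(2+ _)} (i∣m , i∣n) with ∃prime∣ {i} (s≤s (s≤s z≤n))
... | r , pr , r∣i = ⊥-elim (noCommon r pr (∣-trans r∣i i∣m) (∣-trans r∣i i∣n))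

coprime-prime^ : ∀ {x} → Prime p → ¬ (p ∣ x) → ∀ e → Coprime x (p ^ e)
coprime-prime^ {p} pp p∤x e = noCommonPrime⇒coprime
  λ r pr r∣x r∣p^e → p∤x (subst (_∣ _) (prime∣prime^⇒≡ e pr pp r∣p^e) r∣x)

solve-linear : ∀ {u} m L → .{{NonZero L}} → Coprime u L → ∃ λ c → L ∣ c * u + m
solve-linear {u} m (suc L) coprime with coprime-Bézout coprime
... | Bézout.+- x y 1+yL≡xu = m * L * x , divides (m + m * L * y) (begin
      m * L * x * u + m           ≡⟨ cong (_+ m) (trans (*-assoc (m * L) x u) (cong (m * L *_) (sym 1+yL≡xu))) ⟩
      m * L * (1 + y * suc L) + m ≡⟨ identity m L y ⟩
      (m + m * L * y) * suc L     ∎)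
  where
  open ≡-Reasoning
  identity : ∀ m L y → m * L * (1 + y * suc L) + m ≡ (m + m * L * y) * suc L
  identity = solve-∀
... | Bézout.-+ x y 1+xu≡yL = m * x , divides (m * y) (begin
      m * x * u + m    ≡⟨ identity m x u ⟩
      m * (1 + x * u)  ≡⟨ cong (m *_) 1+xu≡yL ⟩
      m * (y * suc L)  ≡⟨ *-assoc m y (suc L) ⟨
      m * y * suc L    ∎)
  where
  open ≡-Reasoning
  identity : ∀ m x u → m * x * u + m ≡ m * (1 + x * u)
  identity = solve-∀

valuation : ∀ p x k → ¬ (p ^ suc k ∣ x) → ∃ λ j → j ≤ k × p ^ j ∣ x × ¬ (p ^ suc j ∣ x)
valuation p x zero    p∤x = 0 , z≤n , 1∣ x , p∤x
valuation p x (suc k) p^2+k∤x with p ^ suc k ∣? x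
... | yes p^1+k∣x = suc k , ≤-refl , p^1+k∣x , p^2+k∤x
... | no  p^1+k∤x with valuation p x k p^1+k∤x
...   | j , j≤k , p^j∣x , p^1+j∤x = j , m≤n⇒m≤1+n j≤k , p^j∣x , p^1+j∤x

pow-mono-∣ : ∀ p {i j} → i ≤ j → p ^ i ∣ p ^ j
pow-mono-∣ p {i} {j} i≤j = divides (p ^ (j ∸ i)) (begin
  p ^ j               ≡⟨ cong (p ^_) (m+[n∸m]≡n i≤j) ⟨
  p ^ (i + (j ∸ i))   ≡⟨ ^-distribˡ-+-* p i (j ∸ i) ⟩
  p ^ i * p ^ (j ∸ i) ≡⟨ *-comm (p ^ i) _ ⟩
  p ^ (j ∸ i) * p ^ i ∎)
  where open ≡-Reasoning

exact-power-of-sum : ∀ {p j k x y} → j ≤ k → p ^ k ∣ x + y → ¬ (p ^ suc k ∣ y) →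
  p ^ j ∣ x → ¬ (p ^ suc j ∣ x) → p ^ j ∣ y × ¬ (p ^ suc j ∣ y)
exact-power-of-sum {p} {j} {k} {x} {y} j≤k p^k∣x+y p^1+k∤y p^j∣x p^1+j∤x =
  ∣m+n∣m⇒∣n (∣-trans (pow-mono-∣ p j≤k) p^k∣x+y) p^j∣x , p^1+j∤y
  where
  p^1+j∤y : ¬ (p ^ suc j ∣ y)
  p^1+j∤y p^1+j∣y with m≤n⇒m<n∨m≡n j≤k
  ... | inj₂ refl = p^1+k∤y p^1+j∣y
  ... | inj₁ j<k  =
    p^1+j∤x (∣m+n∣m⇒∣n (subst (p ^ suc j ∣_) (+-comm x y) (∣-trans (pow-mono-∣ p j<k) p^k∣x+y)) p^1+j∣y)

gcd-exact-part : ∀ {p N k q s M} .{{_ : NonZero p}} .{{_ : NonZero q}} → ¬ (p ∣ N) → p ^ suc k ∣ M → M ≡ N * p ^ k * q →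
  gcd s M * q ≡ M → N * p ^ k ∣ s × ¬ (p ^ suc k ∣ s)
gcd-exact-part {p} {N} {k} {q} {s} {M} p∤N P∣M M≡ gcd*q≡M =
  subst (_∣ s) gcd≡ (gcd[m,n]∣m s M) ,
  λ P∣s → p∤N (*-cancelʳ-∣ (p ^ k) {{m^n≢0 p k}} (subst (p ^ suc k ∣_) gcd≡ (gcd-greatest P∣s P∣M)))
  where
  gcd≡ : gcd s M ≡ N * p ^ k
  gcd≡ = *-cancelʳ-≡ (gcd s M) (N * p ^ k) q (trans gcd*q≡M M≡)

-- Take t = 1 + N c, with c chosen so that p ^ suc e divides c x + (x + y) / N.
unit-solution : ∀ {N x y} → Prime p → ¬ (p ∣ x) → ¬ (p ∣ y) → N ∣ x + y →
  ∀ n e → ∃ λ t → NonZero t × Coprime t (N * p ^ n) × N * p ^ suc e ∣ t * x + y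
unit-solution {p} {N} {x} {y} pp p∤x p∤y (divides m x+y≡mN) n e =
  suc (N * c) , _ , coprime , divides d tx+y≡dNp^1+e
  where
  instance _ = m^n≢0 p (suc e) {{prime⇒nonZero pp}}
  linear = solve-linear m (p ^ suc e) (coprime-prime^ pp p∤x (suc e))
  c = proj₁ linear
  d = quotient (proj₂ linear)
  tx+y≡dNp^1+e : suc (N * c) * x + y ≡ d * (N * p ^ suc e)
  tx+y≡dNp^1+e = begin
    suc (N * c) * x + y   ≡⟨ identity₁ N c x y ⟩
    (x + y) + N * (c * x) ≡⟨ cong (_+ N * (c * x)) x+y≡mN ⟩
    m * N + N * (c * x)   ≡⟨ identity₂ m N c x ⟩
    N * (c * x + m)       ≡⟨ cong (N *_) (m∣n⇒n≡quotient*m (proj₂ linear)) ⟩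
    N * (d * p ^ suc e)   ≡⟨ identity₃ N d (p ^ suc e) ⟩
    d * (N * p ^ suc e)   ∎
    where
    open ≡-Reasoning
    identity₁ : ∀ N c x y → suc (N * c) * x + y ≡ (x + y) + N * (c * x)
    identity₁ = solve-∀
    identity₂ : ∀ m N c x → m * N + N * (c * x) ≡ N * (c * x + m)
    identity₂ = solve-∀
    identity₃ : ∀ N d P → N * (d * P) ≡ d * (N * P)
    identity₃ = solve-∀
  p∤t : ¬ (p ∣ suc (N * c))
  p∤t p∣t = p∤y (∣m+n∣m⇒∣n p∣tx+y (∣m⇒∣m*n x p∣t))
    where
    p∣tx+y = subst (p ∣_) (sym tx+y≡dNp^1+e) (∣n⇒∣m*n d (∣n⇒∣m*n N (m∣m*n (p ^ e))))
  coprime : Coprime (suc (N * c)) (N * p ^ n)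
  coprime = noCommonPrime⇒coprime λ r pr r∣t r∣Np^n →
    case euclidsLemma N (p ^ n) pr r∣Np^n of λ where
      (inj₁ r∣N)   → prime∤1 pr (∣m+n∣m⇒∣n (subst (r ∣_) (+-comm 1 (N * c)) r∣t) (∣m⇒∣m*n c r∣N))
      (inj₂ r∣p^n) → p∤t (subst (_∣ _) (prime∣prime^⇒≡ n pr pp r∣p^n) r∣t)

-- Congruences and ℤ_M

module Modular (m : ℕ) .{{_ : NonZero m}} where

  infix 4 _≋_
  _≋_ : ℕ → ℕ → Set
  a ≋ b = a % m ≡ b % m

  %-≋ : ∀ a → a % m ≋ a
  %-≋ a = m%n%n≡m%n a m

  +-cong-≋ : ∀ {a b c d} → a ≋ b → c ≋ d → a + c ≋ b + d
  +-cong-≋ {a} {b} {c} {d} a≋b c≋d = begin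
    (a + c) % m         ≡⟨ %-distribˡ-+ a c m ⟩
    (a % m + c % m) % m ≡⟨ cong₂ (λ x y → (x + y) % m) a≋b c≋d ⟩
    (b % m + d % m) % m ≡⟨ %-distribˡ-+ b d m ⟨
    (b + d) % m         ∎
    where open ≡-Reasoning

  *-cong-≋ : ∀ {a b c d} → a ≋ b → c ≋ d → a * c ≋ b * d
  *-cong-≋ {a} {b} {c} {d} a≋b c≋d = begin
    (a * c) % m             ≡⟨ %-distribˡ-* a c m ⟩
    (a % m * (c % m)) % m   ≡⟨ cong₂ (λ x y → (x * y) % m) a≋b c≋d ⟩
    (b % m * (d % m)) % m   ≡⟨ %-distribˡ-* b d m ⟨
    (b * d) % m             ∎
    where open ≡-Reasoning

  +-cong-≋ˡ : ∀ a {c d} → c ≋ d → a + c ≋ a + d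
  +-cong-≋ˡ a = +-cong-≋ {a} refl

  +-cong-≋ʳ : ∀ {a b} c → a ≋ b → a + c ≋ b + c
  +-cong-≋ʳ c a≋b = +-cong-≋ {c = c} a≋b refl

  ∣⇒≋0 : ∀ {a} → m ∣ a → a ≋ 0
  ∣⇒≋0 {a} m∣a = trans (n∣m⇒m%n≡0 a m m∣a) (sym (m*n%n≡0 0 m))

  ≋0⇒∣ : ∀ {a} → a ≋ 0 → m ∣ a
  ≋0⇒∣ {a} a≋0 = m%n≡0⇒n∣m a m (trans a≋0 (m*n%n≡0 0 m))

  +-inverse-≋ : ∀ c → c + (m ∸ c % m) ≋ 0
  +-inverse-≋ c = ∣⇒≋0 (divides (suc (c / m)) (begin
    c + (m ∸ c % m)                   ≡⟨ cong (_+ (m ∸ c % m)) (m≡m%n+[m/n]*n c m) ⟩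
    c % m + c / m * m + (m ∸ c % m)   ≡⟨ swap (c % m) (c / m * m) (m ∸ c % m) ⟩
    c / m * m + (c % m + (m ∸ c % m)) ≡⟨ cong (c / m * m +_) (m+[n∸m]≡n (m%n≤n c m)) ⟩
    c / m * m + m                     ≡⟨ +-comm (c / m * m) m ⟩
    suc (c / m) * m                   ∎))
    where
    open ≡-Reasoning
    swap : ∀ x y z → x + y + z ≡ y + (x + z)
    swap = solve-∀

  +-cancelʳ-≋ : ∀ {a b} c → a + c ≋ b + c → a ≋ b
  +-cancelʳ-≋ {a} {b} c a+c≋b+c = begin
    a % m                         ≡⟨ cong (_% m) (+-identityʳ a) ⟨
    (a + 0) % m                   ≡⟨ +-cong-≋ˡ a (+-inverse-≋ c) ⟨
    (a + (c + c⁻)) % m            ≡⟨ cong (_% m) (+-assoc a c c⁻) ⟨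
    (a + c + c⁻) % m              ≡⟨ +-cong-≋ʳ c⁻ a+c≋b+c ⟩
    (b + c + c⁻) % m              ≡⟨ cong (_% m) (+-assoc b c c⁻) ⟩
    (b + (c + c⁻)) % m            ≡⟨ +-cong-≋ˡ b (+-inverse-≋ c) ⟩
    (b + 0) % m                   ≡⟨ cong (_% m) (+-identityʳ b) ⟩
    b % m                         ∎
    where
    open ≡-Reasoning
    c⁻ = m ∸ c % m

  ∣-resp-≋ : ∀ {d a b} → d ∣ m → a ≋ b → d ∣ a → d ∣ b
  ∣-resp-≋ {d} {a} {b} d∣m a≋b d∣a = ∣%⇒∣ b (subst (d ∣_) a≋b (∣⇒∣% a d∣a))
    where
    ∣[/]*m : ∀ x → d ∣ x / m * m
    ∣[/]*m x = ∣n⇒∣m*n (x / m) d∣m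
    ∣⇒∣% : ∀ x → d ∣ x → d ∣ x % m
    ∣⇒∣% x d∣x = ∣m+n∣m⇒∣n (subst (d ∣_) (trans (m≡m%n+[m/n]*n x m) (+-comm (x % m) _)) d∣x) (∣[/]*m x)
    ∣%⇒∣ : ∀ x → d ∣ x % m → d ∣ x
    ∣%⇒∣ x d∣x%m = subst (d ∣_) (sym (m≡m%n+[m/n]*n x m)) (∣m∣n⇒∣m+n d∣x%m (∣[/]*m x))

  sum-cong-≋ : ∀ {n} {f g : Fin n → ℕ} → (∀ i → f i ≋ g i) → sum f ≋ sum g
  sum-cong-≋ {zero}  f≋g = refl
  sum-cong-≋ {suc n} f≋g = +-cong-≋ (f≋g Fin.zero) (sum-cong-≋ (λ i → f≋g (Fin.suc i)))

module Residues (M : ℕ) .{{_ : NonZero M}} where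
  open Modular M public

  [_] : ℕ → Fin M
  [ n ] = n mod M

  toℕ-[] : ∀ n → toℕ [ n ] ≋ n
  toℕ-[] n = trans (cong (_% M) (Fin.toℕ-fromℕ< (m%n<n n M))) (%-≋ n)

  ≋⇒≡ : ∀ {x y : Fin M} → toℕ x ≋ toℕ y → x ≡ y
  ≋⇒≡ {x} {y} x≋y = Fin.toℕ-injective (begin
    toℕ x     ≡⟨ m<n⇒m%n≡m (Fin.toℕ<n x) ⟨
    toℕ x % M ≡⟨ x≋y ⟩
    toℕ y % M ≡⟨ m<n⇒m%n≡m (Fin.toℕ<n y) ⟩
    toℕ y     ∎)
    where open ≡-Reasoning

  []-cong : ∀ {a b} → a ≋ b → [ a ] ≡ [ b ]
  []-cong {a} {b} a≋b = ≋⇒≡ (trans (toℕ-[] a) (trans a≋b (sym (toℕ-[] b))))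

  infixl 6 _⊕_ _⊖_
  _⊕_ _⊖_ : Fin M → Fin M → Fin M
  x ⊕ y = [ toℕ x + toℕ y ]
  x ⊖ y = [ diff x y ]

  diff-self : ∀ x → diff x x ≡ M
  diff-self x = m+[n∸m]≡n (<⇒≤ (Fin.toℕ<n x))

  diff-+ : ∀ x y → diff x y + toℕ y ≋ toℕ x
  diff-+ x y = begin
    (toℕ x + (M ∸ toℕ y) + toℕ y) % M ≡⟨ cong (_% M) (+-assoc (toℕ x) _ (toℕ y)) ⟩
    (toℕ x + (M ∸ toℕ y + toℕ y)) % M ≡⟨ cong (λ k → (toℕ x + k) % M) (m∸n+n≡m (<⇒≤ (Fin.toℕ<n y))) ⟩
    (toℕ x + M) % M                   ≡⟨ [m+n]%n≡m%n (toℕ x) M ⟩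
    toℕ x % M                         ∎
    where open ≡-Reasoning

  diff-trans : ∀ x y z → diff x y + diff y z ≋ diff x z
  diff-trans x y z = +-cancelʳ-≋ (toℕ z) (begin
    (diff x y + diff y z + toℕ z) % M   ≡⟨ cong (_% M) (+-assoc (diff x y) _ (toℕ z)) ⟩
    (diff x y + (diff y z + toℕ z)) % M ≡⟨ +-cong-≋ˡ (diff x y) (diff-+ y z) ⟩
    (diff x y + toℕ y) % M              ≡⟨ diff-+ x y ⟩
    toℕ x % M                           ≡⟨ diff-+ x z ⟨
    (diff x z + toℕ z) % M              ∎)
    where open ≡-Reasoning

  ⊖-+ : ∀ x y → toℕ (x ⊖ y) + toℕ y ≋ toℕ x
  ⊖-+ x y = trans (+-cong-≋ʳ (toℕ y) (toℕ-[] (diff x y))) (diff-+ x y)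

  ⊖-unique : ∀ {x y z} → toℕ z + toℕ y ≋ toℕ x → z ≡ x ⊖ y
  ⊖-unique {x} {y} z+y≋x = ≋⇒≡ (+-cancelʳ-≋ (toℕ y) (trans z+y≋x (sym (⊖-+ x y))))

  ⊕-⊖ : ∀ x y → x ⊕ y ⊖ y ≡ x
  ⊕-⊖ x y = sym (⊖-unique (sym (toℕ-[] (toℕ x + toℕ y))))

  ⊖-⊕ : ∀ x y → x ⊖ y ⊕ y ≡ x
  ⊖-⊕ x y = ≋⇒≡ (trans (toℕ-[] _) (⊖-+ x y))

  ⊖-involutive : ∀ x y → x ⊖ (x ⊖ y) ≡ y
  ⊖-involutive x y = sym (⊖-unique (trans (cong (_% M) (+-comm (toℕ y) _)) (⊖-+ x y)))

  ⊖-⊕-swap : ∀ x y z → x ⊖ (y ⊕ z) ≡ x ⊖ z ⊖ y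
  ⊖-⊕-swap x y z = sym (⊖-unique (begin
    (toℕ (x ⊖ z ⊖ y) + toℕ (y ⊕ z)) % M       ≡⟨ +-cong-≋ˡ (toℕ (x ⊖ z ⊖ y)) (toℕ-[] (toℕ y + toℕ z)) ⟩
    (toℕ (x ⊖ z ⊖ y) + (toℕ y + toℕ z)) % M   ≡⟨ cong (_% M) (+-assoc (toℕ (x ⊖ z ⊖ y)) _ _) ⟨
    (toℕ (x ⊖ z ⊖ y) + toℕ y + toℕ z) % M     ≡⟨ +-cong-≋ʳ (toℕ z) (⊖-+ (x ⊖ z) y) ⟩
    (toℕ (x ⊖ z) + toℕ z) % M                 ≡⟨ ⊖-+ x z ⟩
    toℕ x % M                                 ∎))
    where open ≡-Reasoning

  ⊖-identityʳ : ∀ x → x ⊖ [ 0 ] ≡ x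
  ⊖-identityʳ x = sym (⊖-unique (trans (+-cong-≋ˡ (toℕ x) (toℕ-[] 0)) (cong (_% M) (+-identityʳ (toℕ x)))))

  ∣-diff-isEquivalence : ∀ {d} → d ∣ M → IsEquivalence (λ (x y : Fin M) → d ∣ diff x y)
  ∣-diff-isEquivalence {d} d∣M = record
    { refl  = λ {x} → subst (d ∣_) (sym (diff-self x)) d∣M
    ; sym   = λ {x} {y} d∣xy →
        ∣m+n∣m⇒∣n (∣-resp-≋ d∣M (sym (diff-trans x y x)) (subst (d ∣_) (sym (diff-self x)) d∣M)) d∣xy
    ; trans = λ {x} {y} {z} d∣xy d∣yz → ∣-resp-≋ d∣M (diff-trans x y z) (∣m∣n⇒∣m+n d∣xy d∣yz)
    }

  ∣-linear-diff⇒≋ : ∀ t {u u' w w'} → M ∣ t * diff u u' + diff w w' →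
    t * toℕ u + toℕ w ≋ t * toℕ u' + toℕ w'
  ∣-linear-diff⇒≋ t {u} {u'} {w} {w'} M∣ = begin
    (t * toℕ u + toℕ w) % M                                    ≡⟨ +-cong-≋ (*-cong-≋ {t} refl (diff-+ u u')) (diff-+ w w') ⟨
    (t * (diff u u' + toℕ u') + (diff w w' + toℕ w')) % M      ≡⟨ cong (_% M) (regroup t (diff u u') (toℕ u') (diff w w') (toℕ w')) ⟩
    (t * diff u u' + diff w w' + (t * toℕ u' + toℕ w')) % M    ≡⟨ +-cong-≋ʳ (t * toℕ u' + toℕ w') (∣⇒≋0 M∣) ⟩
    (t * toℕ u' + toℕ w') % M                                  ∎
    where
    open ≡-Reasoning
    regroup : ∀ t x u y w → t * (x + u) + (y + w) ≡ t * x + y + (t * u + w)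
    regroup = solve-∀

δ : Fin n → Fin n → ℕ
δ Fin.zero    Fin.zero    = 1
δ Fin.zero    (Fin.suc _) = 0
δ (Fin.suc _) Fin.zero    = 0
δ (Fin.suc c) (Fin.suc x) = δ c x

δ-refl : ∀ (c : Fin n) → δ c c ≡ 1
δ-refl Fin.zero    = refl
δ-refl (Fin.suc c) = δ-refl c

δ-≢ : ∀ {c x : Fin n} → c ≢ x → δ c x ≡ 0
δ-≢ {c = Fin.zero}  {Fin.zero}  c≢x = ⊥-elim (c≢x refl)
δ-≢ {c = Fin.zero}  {Fin.suc x} c≢x = refl
δ-≢ {c = Fin.suc c} {Fin.zero}  c≢x = refl
δ-≢ {c = Fin.suc c} {Fin.suc x} c≢x = δ-≢ (c≢x ∘ cong Fin.suc)

δ-sym : ∀ (c x : Fin n) → δ c x ≡ δ x c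
δ-sym Fin.zero    Fin.zero    = refl
δ-sym Fin.zero    (Fin.suc x) = refl
δ-sym (Fin.suc c) Fin.zero    = refl
δ-sym (Fin.suc c) (Fin.suc x) = δ-sym c x

δ-cong-⇔ : ∀ {a b a' b' : Fin n} → (a ≡ b → a' ≡ b') → (a' ≡ b' → a ≡ b) → δ a b ≡ δ a' b'
δ-cong-⇔ {a = a} {b} {a'} {b'} to from with a Fin.≟ b
... | yes refl = trans (δ-refl a) (sym (subst (λ x → δ a' x ≡ 1) (to refl) (δ-refl a')))
... | no  a≢b  = trans (δ-≢ a≢b) (sym (δ-≢ (a≢b ∘ from)))

sum-δ : ∀ (c : Fin n) (f : Fin n → ℕ) → sum (λ x → δ c x * f x) ≡ f c
sum-δ {suc n} Fin.zero f = begin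
  f Fin.zero + 0 + sum (λ x → 0 * f (Fin.suc x)) ≡⟨ cong₂ _+_ (+-identityʳ (f Fin.zero)) (sum-replicate-zero n) ⟩
  f Fin.zero + 0                                 ≡⟨ +-identityʳ (f Fin.zero) ⟩
  f Fin.zero                                     ∎
  where open ≡-Reasoning
sum-δ {suc n} (Fin.suc c) f = sum-δ c (f ∘ Fin.suc)

sum-ones : sum {n} (λ _ → 1) ≡ n
sum-ones {zero}  = refl
sum-ones {suc n} = cong suc (sum-ones {n})

≤-sum : ∀ (f : Fin n → ℕ) i → f i ≤ sum f
≤-sum f Fin.zero    = m≤m+n _ _
≤-sum f (Fin.suc i) = ≤-trans (≤-sum (f ∘ Fin.suc) i) (m≤n+m _ (f Fin.zero))

+≤sum : ∀ (f : Fin n → ℕ) {i j} → i ≢ j → f i + f j ≤ sum f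
+≤sum f {Fin.zero}  {Fin.zero}  i≢j = ⊥-elim (i≢j refl)
+≤sum f {Fin.zero}  {Fin.suc j} i≢j = +-monoʳ-≤ (f Fin.zero) (≤-sum (f ∘ Fin.suc) j)
+≤sum f {Fin.suc i} {Fin.zero}  i≢j =
  subst (_≤ sum f) (+-comm (f Fin.zero) _) (+-monoʳ-≤ (f Fin.zero) (≤-sum (f ∘ Fin.suc) i))
+≤sum f {Fin.suc i} {Fin.suc j} i≢j =
  ≤-trans (+≤sum (f ∘ Fin.suc) (i≢j ∘ cong Fin.suc)) (m≤n+m _ (f Fin.zero))

positive⇒≤sum : ∀ (f : Fin n → ℕ) → (∀ i → f i ≢ 0) → n ≤ sum f
positive⇒≤sum {zero}  f f≢0 = z≤n
positive⇒≤sum {suc n} f f≢0 = +-mono-≤ (n≢0⇒n>0 (f≢0 Fin.zero)) (positive⇒≤sum (f ∘ Fin.suc) (f≢0 ∘ Fin.suc))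

positive∧sum≡n⇒≡1 : ∀ (f : Fin n → ℕ) → (∀ i → f i ≢ 0) → sum f ≡ n → ∀ i → f i ≡ 1
positive∧sum≡n⇒≡1 {suc n} f f≢0 sum≡1+n i with f Fin.zero in f₀≡ | f≢0 Fin.zero
... | zero  | f₀≢0 = ⊥-elim (f₀≢0 refl)
... | suc a | _    = go i
  where
  rest = sum (f ∘ Fin.suc)
  a+rest≡n : a + rest ≡ n
  a+rest≡n = suc-injective sum≡1+n
  a≡0 : a ≡ 0
  a≡0 = n≤0⇒n≡0 (+-cancelʳ-≤ rest a 0
          (subst (_≤ rest) (sym a+rest≡n) (positive⇒≤sum (f ∘ Fin.suc) (f≢0 ∘ Fin.suc))))
  go : ∀ i → f i ≡ 1
  go Fin.zero    = trans f₀≡ (cong suc a≡0)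
  go (Fin.suc i) = positive∧sum≡n⇒≡1 (f ∘ Fin.suc) (f≢0 ∘ Fin.suc) (trans (cong (_+ rest) (sym a≡0)) a+rest≡n) i

-- Mask polynomials and Tijdeman's theorem

module GroupSemiring (M : ℕ) .{{_ : NonZero M}} where
  open Residues M

  -- F : Mask stands for Σₓ F x · Xˣ in ℕ[X]/(X^M − 1), and _⊛_ is its multiplication.
  Mask : Set
  Mask = Fin M → ℕ

  infixl 6 _⊞_
  infixl 7 _⊛_

  _⊞_ : Mask → Mask → Mask
  (F ⊞ G) x = F x + G x

  _⊛_ : Mask → Mask → Mask
  (F ⊛ G) x = sum (λ h → F h * G (x ⊖ h))

  𝟘 ε : Mask
  𝟘 _ = 0
  ε   = δ [ 0 ]

  reflection : Fin M → Permutation M M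
  reflection x = permutation (x ⊖_) (x ⊖_) (⊖-involutive x) (⊖-involutive x)

  translation : Fin M → Permutation M M
  translation k = permutation (_⊕ k) (_⊖ k) (λ x → ⊖-⊕ x k) (λ x → ⊕-⊖ x k)

  ⊛-cong : ∀ {F F' G G'} → F ≗ F' → G ≗ G' → F ⊛ G ≗ F' ⊛ G'
  ⊛-cong F≗F' G≗G' x = sum-cong-≗ (λ h → cong₂ _*_ (F≗F' h) (G≗G' (x ⊖ h)))

  ⊛-congʳ : ∀ G {F F'} → F ≗ F' → F ⊛ G ≗ F' ⊛ G
  ⊛-congʳ G F≗F' = ⊛-cong {G = G} F≗F' (λ _ → refl)

  ⊛-comm : ∀ F G → F ⊛ G ≗ G ⊛ F
  ⊛-comm F G x = trans (∑-permute (λ h → F h * G (x ⊖ h)) (reflection x))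
    (sum-cong-≗ λ h → trans (cong (λ y → F (x ⊖ h) * G y) (⊖-involutive x h)) (*-comm (F (x ⊖ h)) (G h)))

  ⊛-assoc : ∀ F G H → (F ⊛ G) ⊛ H ≗ F ⊛ (G ⊛ H)
  ⊛-assoc F G H x = begin
    sum (λ h → sum (λ k → F k * G (h ⊖ k)) * H (x ⊖ h))
      ≡⟨ sum-cong-≗ (λ h → *-distribʳ-sum (H (x ⊖ h)) (λ k → F k * G (h ⊖ k))) ⟩
    sum (λ h → sum (λ k → F k * G (h ⊖ k) * H (x ⊖ h)))
      ≡⟨ ∑-comm (λ h k → F k * G (h ⊖ k) * H (x ⊖ h)) ⟩
    sum (λ k → sum (λ h → F k * G (h ⊖ k) * H (x ⊖ h)))
      ≡⟨ sum-cong-≗ (λ k → trans (sum-cong-≗ (λ h → *-assoc (F k) (G (h ⊖ k)) (H (x ⊖ h))))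
                                 (sym (*-distribˡ-sum (F k) (λ h → G (h ⊖ k) * H (x ⊖ h))))) ⟩
    sum (λ k → F k * sum (λ h → G (h ⊖ k) * H (x ⊖ h)))
      ≡⟨ sum-cong-≗ (λ k → cong (F k *_) (trans (∑-permute (λ h → G (h ⊖ k) * H (x ⊖ h)) (translation k))
            (sum-cong-≗ λ j → cong₂ (λ u v → G u * H v) (⊕-⊖ j k) (⊖-⊕-swap x j k)))) ⟩
    sum (λ k → F k * sum (λ j → G j * H (x ⊖ k ⊖ j)))
      ∎
    where open ≡-Reasoning

  ⊛-identityˡ : ∀ F → ε ⊛ F ≗ F
  ⊛-identityˡ F x = trans (sum-δ [ 0 ] (λ h → F (x ⊖ h))) (cong F (⊖-identityʳ x))

  ⊛-distribʳ : ∀ F G H → (G ⊞ H) ⊛ F ≗ G ⊛ F ⊞ H ⊛ F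
  ⊛-distribʳ F G H x = trans (sum-cong-≗ (λ h → *-distribʳ-+ (F (x ⊖ h)) (G h) (H h)))
    (∑-distrib-+ (λ h → G h * F (x ⊖ h)) (λ h → H h * F (x ⊖ h)))

  ⊛-zeroˡ : ∀ F → 𝟘 ⊛ F ≗ 𝟘
  ⊛-zeroˡ F x = sum-replicate-zero M

  commutativeSemiring : CommutativeSemiring _ _
  commutativeSemiring = record { isCommutativeSemiring = isCommutativeSemiring }
    where
    open import Algebra.Structures {A = Mask} _≗_ using (IsCommutativeSemiring)
    open import Algebra.Structures.Biased {A = Mask} _≗_ using (isCommutativeMonoidˡ; isCommutativeSemiringˡ)
    ≗-isEquivalence : IsEquivalence {A = Mask} _≗_
    ≗-isEquivalence = record { refl = λ _ → refl ; sym = λ e x → sym (e x) ; trans = λ e e' x → trans (e x) (e' x) }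
    isCommutativeSemiring : IsCommutativeSemiring _⊞_ _⊛_ 𝟘 ε
    isCommutativeSemiring = isCommutativeSemiringˡ record
      { +-isCommutativeMonoid = isCommutativeMonoidˡ record
        { isSemigroup = record
          { isMagma = record { isEquivalence = ≗-isEquivalence ; ∙-cong = λ e e' x → cong₂ _+_ (e x) (e' x) }
          ; assoc = λ F G H x → +-assoc (F x) (G x) (H x) }
        ; identityˡ = λ F x → refl
        ; comm = λ F G x → +-comm (F x) (G x) }
      ; *-isCommutativeMonoid = isCommutativeMonoidˡ record
        { isSemigroup = record
          { isMagma = record { isEquivalence = ≗-isEquivalence ; ∙-cong = ⊛-cong }
          ; assoc = ⊛-assoc }
        ; identityˡ = ⊛-identityˡ
        ; comm = ⊛-comm }
      ; distribʳ = ⊛-distribʳ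
      ; zeroˡ = ⊛-zeroˡ }

module Dilation (M : ℕ) .{{_ : NonZero M}} where
  open Residues M
  open GroupSemiring M
  open CommutativeSemiring commutativeSemiring using (semiring)
  open import Algebra.Properties.Semiring.Exp semiring using (^-congˡ; ^-congʳ) renaming (_^_ to _^ᶜ_)
  open import Algebra.Properties.Semiring.Mult semiring using () renaming (_×_ to _·_)
  open import Algebra.Properties.Semiring.Sum semiring using () renaming (sum to ∑)

  dilate : ℕ → Mask → Mask
  dilate t F x = sum (λ h → δ [ t * toℕ h ] x * F h)

  ·-apply : ∀ n F x → (n · F) x ≡ n * F x
  ·-apply zero    F x = refl
  ·-apply (suc n) F x = cong (F x +_) (·-apply n F x)

  ∑-apply : ∀ {k} (Fs : Fin k → Mask) x → ∑ Fs x ≡ sum (λ i → Fs i x)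
  ∑-apply {zero}  Fs x = refl
  ∑-apply {suc k} Fs x = cong (Fs Fin.zero x +_) (∑-apply (Fs ∘ Fin.suc) x)

  δ-decomposition : ∀ F → F ≗ ∑ (λ c → F c · δ c)
  δ-decomposition F x = sym (begin
    ∑ (λ c → F c · δ c) x          ≡⟨ ∑-apply (λ c → F c · δ c) x ⟩
    sum (λ c → (F c · δ c) x)      ≡⟨ sum-cong-≗ (λ c → trans (·-apply (F c) (δ c) x) (*-comm (F c) (δ c x))) ⟩
    sum (λ c → δ c x * F c)        ≡⟨ sum-cong-≗ (λ c → cong (_* F c) (δ-sym c x)) ⟩
    sum (λ c → δ x c * F c)        ≡⟨ sum-δ x F ⟩
    F x                            ∎)
    where open ≡-Reasoning

  δ-⊛ : ∀ c F x → (δ c ⊛ F) x ≡ F (x ⊖ c)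
  δ-⊛ c F x = sum-δ c (λ h → F (x ⊖ h))

  δ-^ : ∀ n c → δ c ^ᶜ n ≗ δ [ n * toℕ c ]
  δ-^ zero    c x = refl
  δ-^ (suc n) c x = begin
    (δ c ⊛ δ c ^ᶜ n) x          ≡⟨ ⊛-cong {δ c} (λ _ → refl) (δ-^ n c) x ⟩
    (δ c ⊛ δ [ n * toℕ c ]) x   ≡⟨ δ-⊛ c (δ [ n * toℕ c ]) x ⟩
    δ [ n * toℕ c ] (x ⊖ c)     ≡⟨ δ-cong-⇔ to from ⟩
    δ [ suc n * toℕ c ] x       ∎
    where
    open ≡-Reasoning
    step : toℕ [ n * toℕ c ] + toℕ c ≋ toℕ [ suc n * toℕ c ]
    step = trans (+-cong-≋ʳ (toℕ c) (toℕ-[] (n * toℕ c)))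
             (trans (cong (_% M) (+-comm (n * toℕ c) (toℕ c))) (sym (toℕ-[] (suc n * toℕ c))))
    to : [ n * toℕ c ] ≡ x ⊖ c → [ suc n * toℕ c ] ≡ x
    to e = ≋⇒≡ (trans (sym step) (subst (λ y → toℕ y + toℕ c ≋ toℕ x) (sym e) (⊖-+ x c)))
    from : [ suc n * toℕ c ] ≡ x → [ n * toℕ c ] ≡ x ⊖ c
    from e = ⊖-unique (subst (λ y → toℕ [ n * toℕ c ] + toℕ c ≋ toℕ y) e step)

  dilate-cong : ∀ t {F G} → F ≗ G → dilate t F ≗ dilate t G
  dilate-cong t F≗G x = sum-cong-≗ (λ h → cong (δ [ t * toℕ h ] x *_) (F≗G h))

  dilate-δ : ∀ t c → dilate t (δ c) ≗ δ [ t * toℕ c ]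
  dilate-δ t c x = trans (sum-cong-≗ (λ h → *-comm (δ [ t * toℕ h ] x) (δ c h))) (sum-δ c (λ h → δ [ t * toℕ h ] x))

  dilate-⊞ : ∀ t F G → dilate t (F ⊞ G) ≗ dilate t F ⊞ dilate t G
  dilate-⊞ t F G x = trans (sum-cong-≗ (λ h → *-distribˡ-+ (δ [ t * toℕ h ] x) (F h) (G h)))
    (∑-distrib-+ (λ h → δ [ t * toℕ h ] x * F h) (λ h → δ [ t * toℕ h ] x * G h))

  dilate-𝟘 : ∀ t → dilate t 𝟘 ≗ 𝟘
  dilate-𝟘 t x = trans (sum-cong-≗ {M} (λ h → *-zeroʳ (δ [ t * toℕ h ] x))) (sum-replicate-zero M)

  dilate-1 : ∀ F → dilate 1 F ≗ F
  dilate-1 F x = trans (sum-cong-≗ (λ h → cong (_* F h) (trans (cong (λ y → δ y x) [1*h]≡h) (δ-sym h x)))) (sum-δ x F)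
    where
    [1*h]≡h : ∀ {h} → [ 1 * toℕ h ] ≡ h
    [1*h]≡h {h} = ≋⇒≡ (trans (toℕ-[] (1 * toℕ h)) (cong (_% M) (*-identityˡ (toℕ h))))

  dilate-dilate : ∀ s t F → dilate s (dilate t F) ≗ dilate (s * t) F
  dilate-dilate s t F x = begin
    sum (λ h → δ [ s * toℕ h ] x * sum (λ k → δ [ t * toℕ k ] h * F k))
      ≡⟨ sum-cong-≗ (λ h → *-distribˡ-sum (δ [ s * toℕ h ] x) (λ k → δ [ t * toℕ k ] h * F k)) ⟩
    sum (λ h → sum (λ k → δ [ s * toℕ h ] x * (δ [ t * toℕ k ] h * F k)))
      ≡⟨ ∑-comm (λ h k → δ [ s * toℕ h ] x * (δ [ t * toℕ k ] h * F k)) ⟩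
    sum (λ k → sum (λ h → δ [ s * toℕ h ] x * (δ [ t * toℕ k ] h * F k)))
      ≡⟨ sum-cong-≗ (λ k → trans (sum-cong-≗ (λ h → x*[y*z]≡y*[x*z] (δ [ s * toℕ h ] x) (δ [ t * toℕ k ] h) (F k)))
                                 (sum-δ [ t * toℕ k ] (λ h → δ [ s * toℕ h ] x * F k))) ⟩
    sum (λ k → δ [ s * toℕ [ t * toℕ k ] ] x * F k)
      ≡⟨ sum-cong-≗ (λ k → cong (λ y → δ y x * F k) ([]-cong (trans (*-cong-≋ {s} refl (toℕ-[] (t * toℕ k)))
                                                                   (cong (_% M) (sym (*-assoc s t (toℕ k))))))) ⟩
    sum (λ k → δ [ s * t * toℕ k ] x * F k)
      ∎
    where
    open ≡-Reasoning
    open import Algebra.Properties.CommutativeSemigroup *-commutativeSemigroup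
      using () renaming (x∙yz≈y∙xz to x*[y*z]≡y*[x*z])

  dilate-⊛ : ∀ t F G x → (dilate t F ⊛ G) x ≡ sum (λ k → F k * G (x ⊖ [ t * toℕ k ]))
  dilate-⊛ t F G x = begin
    sum (λ h → sum (λ k → δ [ t * toℕ k ] h * F k) * G (x ⊖ h))
      ≡⟨ sum-cong-≗ (λ h → *-distribʳ-sum (G (x ⊖ h)) (λ k → δ [ t * toℕ k ] h * F k)) ⟩
    sum (λ h → sum (λ k → δ [ t * toℕ k ] h * F k * G (x ⊖ h)))
      ≡⟨ ∑-comm (λ h k → δ [ t * toℕ k ] h * F k * G (x ⊖ h)) ⟩
    sum (λ k → sum (λ h → δ [ t * toℕ k ] h * F k * G (x ⊖ h)))
      ≡⟨ sum-cong-≗ (λ k → trans (sum-cong-≗ (λ h → *-assoc (δ [ t * toℕ k ] h) (F k) (G (x ⊖ h))))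
                                 (sum-δ [ t * toℕ k ] (λ h → F k * G (x ⊖ h)))) ⟩
    sum (λ k → F k * G (x ⊖ [ t * toℕ k ]))
      ∎
    where open ≡-Reasoning

  sum-⊛ : ∀ F G → sum (F ⊛ G) ≡ sum F * sum G
  sum-⊛ F G = begin
    sum (λ x → sum (λ h → F h * G (x ⊖ h))) ≡⟨ ∑-comm (λ x h → F h * G (x ⊖ h)) ⟩
    sum (λ h → sum (λ x → F h * G (x ⊖ h))) ≡⟨ sum-cong-≗ (λ h → sym (*-distribˡ-sum (F h) (λ x → G (x ⊖ h)))) ⟩
    sum (λ h → F h * sum (λ x → G (x ⊖ h))) ≡⟨ sum-cong-≗ (λ h → cong (F h *_) (sum-translate h)) ⟩
    sum (λ h → F h * sum G)                 ≡⟨ *-distribʳ-sum (sum G) F ⟨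
    sum F * sum G                           ∎
    where
    open ≡-Reasoning
    sum-translate : ∀ h → sum (λ x → G (x ⊖ h)) ≡ sum G
    sum-translate h = trans (∑-permute (λ x → G (x ⊖ h)) (translation h)) (sum-cong-≗ (λ j → cong G (⊕-⊖ j h)))

  sum-^ : ∀ F n → sum (F ^ᶜ n) ≡ sum F ^ n
  sum-^ F zero    = trans (sum-cong-≗ (λ h → sym (*-identityʳ (ε h)))) (sum-δ [ 0 ] (λ _ → 1))
  sum-^ F (suc n) = trans (sum-⊛ F (F ^ᶜ n)) (cong (sum F *_) (sum-^ F n))

  sum-dilate : ∀ t F → sum (dilate t F) ≡ sum F
  sum-dilate t F = trans (∑-comm (λ x h → δ [ t * toℕ h ] x * F h)) (sum-cong-≗ (λ h → sum-δ [ t * toℕ h ] (λ _ → F h)))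

  module _ {q : ℕ} (pq : Prime q) where
    private
      instance _ = prime⇒nonZero pq
      module Q = Modular q
    open import Algebra.Properties.CommutativeSemiring.Binomial commutativeSemiring using (theorem; binomialTerm)

    -- Only the two extreme binomial terms survive modulo q.
    binomialTerm-≋ : ∀ F G x (i : Fin (suc q)) →
      (q C toℕ i) * (F ^ᶜ toℕ i ⊛ G ^ᶜ (q ∸ toℕ i)) x Q.≋ δ (fromℕ q) i * (F ^ᶜ q) x + δ Fin.zero i * (G ^ᶜ q) x
    binomialTerm-≋ F G x Fin.zero = cong (_% q) (begin
      (ε ⊛ G ^ᶜ q) x + 0                           ≡⟨ +-identityʳ _ ⟩
      (ε ⊛ G ^ᶜ q) x                               ≡⟨ ⊛-identityˡ (G ^ᶜ q) x ⟩
      (G ^ᶜ q) x                                   ≡⟨ +-identityʳ _ ⟨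
      (G ^ᶜ q) x + 0                               ≡⟨ cong (λ d → d * (F ^ᶜ q) x + ((G ^ᶜ q) x + 0)) (δ-≢ fromℕq≢0) ⟨
      δ (fromℕ q) Fin.zero * (F ^ᶜ q) x + ((G ^ᶜ q) x + 0) ∎)
      where
      open ≡-Reasoning
      fromℕq≢0 : fromℕ q ≢ Fin.zero
      fromℕq≢0 q≡0 = ≢-nonZero⁻¹ q (trans (sym (Fin.toℕ-fromℕ q)) (cong toℕ q≡0))
    binomialTerm-≋ F G x (Fin.suc j) with Fin.suc j Fin.≟ fromℕ q
    ... | yes 1+j≡q = cong (_% q) (begin
      term (Fin.suc j)                             ≡⟨ cong term 1+j≡q ⟩
      term (fromℕ q)                               ≡⟨ top (toℕ (fromℕ q)) (Fin.toℕ-fromℕ q) ⟩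
      (F ^ᶜ q) x                                   ≡⟨ *-identityˡ _ ⟨
      1 * (F ^ᶜ q) x                               ≡⟨ +-identityʳ _ ⟨
      1 * (F ^ᶜ q) x + 0                           ≡⟨ cong (λ d → d * (F ^ᶜ q) x + 0) (δ-refl (fromℕ q)) ⟨
      δ (fromℕ q) (fromℕ q) * (F ^ᶜ q) x + 0       ≡⟨ cong (λ i → δ (fromℕ q) i * (F ^ᶜ q) x + 0) 1+j≡q ⟨
      δ (fromℕ q) (Fin.suc j) * (F ^ᶜ q) x + 0     ∎)
      where
      open ≡-Reasoning
      term : Fin (suc q) → ℕ
      term i = (q C toℕ i) * (F ^ᶜ toℕ i ⊛ G ^ᶜ (q ∸ toℕ i)) x
      top : ∀ k → k ≡ q → (q C k) * (F ^ᶜ k ⊛ G ^ᶜ (q ∸ k)) x ≡ (F ^ᶜ q) x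
      top k refl rewrite nCn≡1 q | n∸n≡0 q =
        trans (+-identityʳ _) (trans (⊛-comm (F ^ᶜ q) ε x) (⊛-identityˡ (F ^ᶜ q) x))
    ... | no  1+j≢q = trans (Q.∣⇒≋0 (∣m⇒∣m*n _ (prime∣C pq (s≤s z≤n) 1+j<q)))
                            (cong (λ d → (d * (F ^ᶜ q) x + 0) % q) (sym (δ-≢ (1+j≢q ∘ sym))))
      where
      1+j<q : suc (toℕ j) < q
      1+j<q = ≤∧≢⇒< (≤-pred (Fin.toℕ<n (Fin.suc j)))
                    (λ 1+j≡q → 1+j≢q (Fin.toℕ-injective (trans 1+j≡q (sym (Fin.toℕ-fromℕ q)))))

    freshmans-dream : ∀ F G x → ((F ⊞ G) ^ᶜ q) x Q.≋ (F ^ᶜ q) x + (G ^ᶜ q) x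
    freshmans-dream F G x = begin
      ((F ⊞ G) ^ᶜ q) x % q
        ≡⟨ cong (_% q) (trans (theorem q F G x) (∑-apply (binomialTerm F G q) x)) ⟩
      sum {suc q} (λ i → binomialTerm F G q i x) % q
        ≡⟨ cong (_% q) (sum-cong-≗ {suc q} (λ i → ·-apply (q C toℕ i) (F ^ᶜ toℕ i ⊛ G ^ᶜ (q ∸ toℕ i)) x)) ⟩
      sum {suc q} (λ i → (q C toℕ i) * (F ^ᶜ toℕ i ⊛ G ^ᶜ (q ∸ toℕ i)) x) % q
        ≡⟨ Q.sum-cong-≋ {suc q} (binomialTerm-≋ F G x) ⟩
      sum (λ i → δ (fromℕ q) i * Fq + δ Fin.zero i * Gq) % q
        ≡⟨ cong (_% q) (∑-distrib-+ {suc q} (λ i → δ (fromℕ q) i * Fq) (λ i → δ Fin.zero i * Gq)) ⟩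
      (sum (λ i → δ (fromℕ q) i * Fq) + sum {suc q} (λ i → δ Fin.zero i * Gq)) % q
        ≡⟨ cong (_% q) (cong₂ _+_ (sum-δ (fromℕ q) (λ _ → Fq)) (sum-δ {suc q} Fin.zero (λ _ → Gq))) ⟩
      (Fq + Gq) % q
        ∎
      where
      open ≡-Reasoning
      Fq = (F ^ᶜ q) x
      Gq = (G ^ᶜ q) x

    Frobenius : Mask → Set
    Frobenius F = ∀ x → (F ^ᶜ q) x Q.≋ dilate q F x

    private
      frobenius-resp : ∀ {F G} → F ≗ G → Frobenius F → Frobenius G
      frobenius-resp {F} {G} F≗G frobF x =
        trans (cong (_% q) (sym (^-congˡ q F≗G x))) (trans (frobF x) (cong (_% q) (dilate-cong q F≗G x)))

      frobenius-𝟘 : Frobenius 𝟘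
      frobenius-𝟘 x = cong (_% q) (trans (𝟘^q x) (sym (dilate-𝟘 q x)))
        where
        𝟘^q : 𝟘 ^ᶜ q ≗ 𝟘
        𝟘^q x = trans (^-congʳ 𝟘 (sym (suc-pred q)) x) (⊛-zeroˡ (𝟘 ^ᶜ pred q) x)

      frobenius-δ : ∀ c → Frobenius (δ c)
      frobenius-δ c x = cong (_% q) (trans (δ-^ q c x) (sym (dilate-δ q c x)))

      frobenius-⊞ : ∀ {F G} → Frobenius F → Frobenius G → Frobenius (F ⊞ G)
      frobenius-⊞ {F} {G} frobF frobG x = begin
        ((F ⊞ G) ^ᶜ q) x % q                  ≡⟨ freshmans-dream F G x ⟩
        ((F ^ᶜ q) x + (G ^ᶜ q) x) % q         ≡⟨ Q.+-cong-≋ (frobF x) (frobG x) ⟩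
        (dilate q F x + dilate q G x) % q     ≡⟨ cong (_% q) (dilate-⊞ q F G x) ⟨
        dilate q (F ⊞ G) x % q                ∎
        where open ≡-Reasoning

      frobenius-· : ∀ n {F} → Frobenius F → Frobenius (n · F)
      frobenius-· zero    frobF = frobenius-𝟘
      frobenius-· (suc n) frobF = frobenius-⊞ frobF (frobenius-· n frobF)

      frobenius-∑ : ∀ {k} (Fs : Fin k → Mask) → (∀ i → Frobenius (Fs i)) → Frobenius (∑ Fs)
      frobenius-∑ {zero}  Fs frobFs = frobenius-𝟘
      frobenius-∑ {suc k} Fs frobFs = frobenius-⊞ (frobFs Fin.zero) (frobenius-∑ (Fs ∘ Fin.suc) (frobFs ∘ Fin.suc))

    frobenius : ∀ F → Frobenius F
    frobenius F = frobenius-resp (sym ∘ δ-decomposition F)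
      (frobenius-∑ (λ c → F c · δ c) (λ c → frobenius-· (F c) (frobenius-δ c)))

  𝟙 : Mask
  𝟙 _ = 1

  -- Modulo q, (dilate q F ⊛ G) x ≡ (F ^ᶜ q ⊛ G) x = (sum F) ^ (q − 1), which q does not divide;
  -- so the M values of dilate q F ⊛ G are positive, and they sum to M.
  tijdeman-prime : ∀ {q F G} → Prime q → ¬ (q ∣ M) → F ⊛ G ≗ 𝟙 → dilate q F ⊛ G ≗ 𝟙
  tijdeman-prime {q} {F} {G} pq q∤M F⊛G≗𝟙 = positive∧sum≡n⇒≡1 (dilate q F ⊛ G) positive total
    where
    instance _ = prime⇒nonZero pq
    module Q = Modular q
    sumF*sumG≡M : sum F * sum G ≡ M
    sumF*sumG≡M = trans (sym (sum-⊛ F G)) (trans (sum-cong-≗ F⊛G≗𝟙) sum-ones)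
    F^q⊛G≡ : ∀ x → (F ^ᶜ q ⊛ G) x ≡ sum F ^ pred q
    F^q⊛G≡ x = begin
      (F ^ᶜ q ⊛ G) x              ≡⟨ ⊛-congʳ G (^-congʳ F (sym (suc-pred q))) x ⟩
      (F ⊛ F ^ᶜ pred q ⊛ G) x     ≡⟨ ⊛-congʳ G (⊛-comm F (F ^ᶜ pred q)) x ⟩
      (F ^ᶜ pred q ⊛ F ⊛ G) x     ≡⟨ ⊛-assoc (F ^ᶜ pred q) F G x ⟩
      (F ^ᶜ pred q ⊛ (F ⊛ G)) x   ≡⟨ ⊛-cong {F ^ᶜ pred q} (λ _ → refl) F⊛G≗𝟙 x ⟩
      (F ^ᶜ pred q ⊛ 𝟙) x         ≡⟨ sum-cong-≗ (λ h → *-identityʳ ((F ^ᶜ pred q) h)) ⟩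
      sum (F ^ᶜ pred q)           ≡⟨ sum-^ F (pred q) ⟩
      sum F ^ pred q              ∎
      where open ≡-Reasoning
    positive : ∀ x → (dilate q F ⊛ G) x ≢ 0
    positive x dilateF⊛G≡0 =
      q∤M (∣-trans (prime∣^⇒∣ (pred q) pq q∣sumF^) (divides (sum G) (trans (sym sumF*sumG≡M) (*-comm (sum F) (sum G)))))
      where
      q∣sumF^ : q ∣ sum F ^ pred q
      q∣sumF^ = Q.≋0⇒∣ (begin
        sum F ^ pred q % q          ≡⟨ cong (_% q) (F^q⊛G≡ x) ⟨
        (F ^ᶜ q ⊛ G) x % q          ≡⟨ Q.sum-cong-≋ (λ h → Q.*-cong-≋ (frobenius pq F h) (refl {x = G (x ⊖ h) % q})) ⟩
        (dilate q F ⊛ G) x % q      ≡⟨ cong (_% q) dilateF⊛G≡0 ⟩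
        0 % q                       ∎)
        where open ≡-Reasoning
    total : sum (dilate q F ⊛ G) ≡ M
    total = trans (sum-⊛ (dilate q F) G) (trans (cong (_* sum G) (sum-dilate q F)) sumF*sumG≡M)

  tijdeman-product : ∀ {qs F G} → All Prime qs → Coprime (product qs) M → F ⊛ G ≗ 𝟙 → dilate (product qs) F ⊛ G ≗ 𝟙
  tijdeman-product {[]}     {F} {G} []         _        F⊛G≗𝟙 x = trans (⊛-congʳ G (dilate-1 F) x) (F⊛G≗𝟙 x)
  tijdeman-product {q ∷ qs} {F} {G} (pq ∷ pqs) coprime F⊛G≗𝟙 x = begin
    (dilate (q * product qs) F ⊛ G) x          ≡⟨ ⊛-congʳ G (dilate-dilate q (product qs) F) x ⟨
    (dilate q (dilate (product qs) F) ⊛ G) x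
      ≡⟨ tijdeman-prime {G = G} pq q∤M (tijdeman-product {F = F} {G} pqs coprime′ F⊛G≗𝟙) x ⟩
    1                                          ∎
    where
    open ≡-Reasoning
    q∤M : ¬ (q ∣ M)
    q∤M q∣M = prime∤1 pq (subst (q ∣_) (coprime (m∣m*n (product qs) , q∣M)) ∣-refl)
    coprime′ : Coprime (product qs) M
    coprime′ (i∣qs , i∣M) = coprime (∣n⇒∣m*n q i∣qs , i∣M)

  tijdeman : ∀ t .{{_ : NonZero t}} {F G} → Coprime t M → F ⊛ G ≗ 𝟙 → dilate t F ⊛ G ≗ 𝟙
  tijdeman t {F} {G} coprime F⊛G≗𝟙 x =
    trans (cong (λ s → (dilate s F ⊛ G) x) (isFactorisation fac))
      (tijdeman-product {F = F} {G} (factorsPrime fac) (subst (λ s → Coprime s M) (isFactorisation fac) coprime) F⊛G≗𝟙 x)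
    where
    open PrimeFactorisation
    fac = factorise t

-- Tilings

module Tiling {M : ℕ} .{{_ : NonZero M}} {A B : Fin M → Set} (A⊕B : DirectSum M A B) where
  open Residues M
  open GroupSemiring M
  open Dilation M
  open DirectSum A⊕B

  α β : Fin M → Fin M
  α x = proj₁ (cover x)
  β x = proj₁ (proj₂ (cover x))

  α∈A : ∀ x → A (α x)
  α∈A x = proj₁ (proj₂ (proj₂ (cover x)))

  β∈B : ∀ x → B (β x)
  β∈B x = proj₁ (proj₂ (proj₂ (proj₂ (cover x))))

  α+β≋ : ∀ x → toℕ (α x) + toℕ (β x) ≋ toℕ x
  α+β≋ x = trans (sym (%-≋ _)) (cong (_% M) (proj₂ (proj₂ (proj₂ (proj₂ (cover x))))))

  a₀ b₀ : Fin M
  a₀ = α [ 0 ]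
  b₀ = β [ 0 ]

  -- A need not be decidable: x ∈ A exactly when x is the A-component of x + b₀.
  𝟙A 𝟙B : Mask
  𝟙A x = δ (α (x ⊕ b₀)) x
  𝟙B y = δ (β (a₀ ⊕ y)) y

  ∈A⇒𝟙A≡1 : ∀ {x} → A x → 𝟙A x ≡ 1
  ∈A⇒𝟙A≡1 {x} x∈A = subst (λ c → δ c x ≡ 1) (sym α[x⊕b₀]≡x) (δ-refl x)
    where
    α[x⊕b₀]≡x : α (x ⊕ b₀) ≡ x
    α[x⊕b₀]≡x = sym (proj₁ (unique x b₀ _ _ x∈A (β∈B [ 0 ]) (α∈A _) (β∈B _)
                  (trans (sym (toℕ-[] _)) (sym (α+β≋ (x ⊕ b₀))))))

  ∈B⇒𝟙B≡1 : ∀ {y} → B y → 𝟙B y ≡ 1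
  ∈B⇒𝟙B≡1 {y} y∈B = subst (λ c → δ c y ≡ 1) (sym β[a₀⊕y]≡y) (δ-refl y)
    where
    β[a₀⊕y]≡y : β (a₀ ⊕ y) ≡ y
    β[a₀⊕y]≡y = sym (proj₂ (unique a₀ y _ _ (α∈A [ 0 ]) y∈B (α∈A _) (β∈B _)
                  (trans (sym (toℕ-[] _)) (sym (α+β≋ (a₀ ⊕ y))))))

  𝟙A≢0⇒∈A : ∀ {x} → 𝟙A x ≢ 0 → A x
  𝟙A≢0⇒∈A {x} 𝟙Ax≢0 with α (x ⊕ b₀) Fin.≟ x
  ... | yes α≡x = subst A α≡x (α∈A _)
  ... | no  α≢x = ⊥-elim (𝟙Ax≢0 (δ-≢ α≢x))

  𝟙B≢0⇒∈B : ∀ {y} → 𝟙B y ≢ 0 → B y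
  𝟙B≢0⇒∈B {y} 𝟙By≢0 with β (a₀ ⊕ y) Fin.≟ y
  ... | yes β≡y = subst B β≡y (β∈B _)
  ... | no  β≢y = ⊥-elim (𝟙By≢0 (δ-≢ β≢y))

  𝟙A⊛𝟙B≗𝟙 : 𝟙A ⊛ 𝟙B ≗ 𝟙
  𝟙A⊛𝟙B≗𝟙 x = trans (sum-cong-≗ term) (sum-δ (α x) (λ _ → 1))
    where
    x⊖α≡β : x ⊖ α x ≡ β x
    x⊖α≡β = sym (⊖-unique (trans (cong (_% M) (+-comm (toℕ (β x)) _)) (α+β≋ x)))
    term : ∀ h → 𝟙A h * 𝟙B (x ⊖ h) ≡ δ (α x) h * 1
    term h with α x Fin.≟ h
    ... | yes refl = begin
      𝟙A (α x) * 𝟙B (x ⊖ α x) ≡⟨ cong₂ _*_ (∈A⇒𝟙A≡1 (α∈A x)) (trans (cong 𝟙B x⊖α≡β) (∈B⇒𝟙B≡1 (β∈B x))) ⟩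
      1                       ≡⟨ cong (_* 1) (δ-refl (α x)) ⟨
      δ (α x) (α x) * 1       ∎
      where open ≡-Reasoning
    ... | no  α≢h = trans product≡0 (cong (_* 1) (sym (δ-≢ α≢h)))
      where
      product≡0 : 𝟙A h * 𝟙B (x ⊖ h) ≡ 0
      product≡0 with 𝟙A h ≟ 0 | 𝟙B (x ⊖ h) ≟ 0
      ... | yes 𝟙Ah≡0 | _         = cong (_* 𝟙B (x ⊖ h)) 𝟙Ah≡0
      ... | no  _     | yes 𝟙B≡0  = trans (cong (𝟙A h *_) 𝟙B≡0) (*-zeroʳ (𝟙A h))
      ... | no  𝟙Ah≢0 | no  𝟙B≢0 = ⊥-elim (α≢h (sym (proj₁ (unique h (x ⊖ h) (α x) (β x)
        (𝟙A≢0⇒∈A 𝟙Ah≢0) (𝟙B≢0⇒∈B 𝟙B≢0) (α∈A x) (β∈B x)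
        (trans (trans (cong (_% M) (+-comm (toℕ h) _)) (⊖-+ x h)) (sym (α+β≋ x)))))))

  -- Tijdeman's theorem: t A ⊕ B = ℤ_M as well.
  dilated-sum-unique : ∀ t .{{_ : NonZero t}} → Coprime t M → ∀ {u u' w w'} → A u → A u' → B w → B w' →
    t * toℕ u + toℕ w ≋ t * toℕ u' + toℕ w' → u ≡ u'
  dilated-sum-unique t coprime {u} {u'} {w} {w'} u∈A u'∈A w∈B w'∈B tu+w≋tu'+w' with u Fin.≟ u'
  ... | yes u≡u' = u≡u'
  ... | no  u≢u' = ⊥-elim (<⇒≱ (s≤s (s≤s z≤n)) (begin
    2                               ≤⟨ +-mono-≤ (contributes u∈A w∈B refl) (contributes u'∈A w'∈B (sym tu+w≋tu'+w')) ⟩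
    contribution u + contribution u' ≤⟨ +≤sum contribution u≢u' ⟩
    sum contribution                 ≡⟨ dilate-⊛ t 𝟙A 𝟙B x ⟨
    (dilate t 𝟙A ⊛ 𝟙B) x            ≡⟨ tijdeman t {𝟙A} {𝟙B} coprime 𝟙A⊛𝟙B≗𝟙 x ⟩
    1                                ∎))
    where
    open ≤-Reasoning
    x = [ t * toℕ u + toℕ w ]
    contribution : Fin M → ℕ
    contribution k = 𝟙A k * 𝟙B (x ⊖ [ t * toℕ k ])
    contributes : ∀ {v y} → A v → B y → t * toℕ v + toℕ y ≋ t * toℕ u + toℕ w → 1 ≤ contribution v
    contributes {v} {y} v∈A y∈B tv+y≋ = ≤-reflexive (sym (begin-equality
      𝟙A v * 𝟙B (x ⊖ [ t * toℕ v ]) ≡⟨ cong₂ _*_ (∈A⇒𝟙A≡1 v∈A) (trans (cong 𝟙B (sym x⊖tv≡y)) (∈B⇒𝟙B≡1 y∈B)) ⟩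
      1                             ∎))
      where
      x⊖tv≡y : y ≡ x ⊖ [ t * toℕ v ]
      x⊖tv≡y = ⊖-unique (trans (+-cong-≋ˡ (toℕ y) (toℕ-[] (t * toℕ v)))
        (trans (cong (_% M) (+-comm (toℕ y) _)) (trans tv+y≋ (sym (toℕ-[] _)))))

-- Differences of tiles

module Separation {M : ℕ} .{{_ : NonZero M}} {A B : Fin M → Set} (A⊕B : DirectSum M A B)
                  {p N n : ℕ} (pp : Prime p) (M≡Np^n : M ≡ N * p ^ n) where
  open Residues M
  open Tiling A⊕B
  private instance _ = prime⇒nonZero pp

  p^i∣M : ∀ {i} → i ≤ n → p ^ i ∣ M
  p^i∣M i≤n = ∣-trans (pow-mono-∣ p i≤n) (divides N M≡Np^n)

  unit-multiple : ∀ {j x y} → j < n → p ^ j ∣ x → ¬ (p ^ suc j ∣ x) → p ^ j ∣ y → ¬ (p ^ suc j ∣ y) →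
    N * p ^ j ∣ x + y → ∃ λ t → NonZero t × Coprime t M × M ∣ t * x + y
  unit-multiple {j} {x} {y} j<n p^j∣x p^1+j∤x p^j∣y p^1+j∤y Np^j∣x+y
    with unit-solution pp (p∤quotient p^j∣x p^1+j∤x) (p∤quotient p^j∣y p^1+j∤y) N∣x'+y' n (n ∸ suc j)
    where
    p∤quotient : ∀ {z} (p^j∣z : p ^ j ∣ z) → ¬ (p ^ suc j ∣ z) → ¬ (p ∣ quotient p^j∣z)
    p∤quotient {z} p^j∣z p^1+j∤z p∣z' =
      p^1+j∤z (subst (p ^ suc j ∣_) (sym (m∣n⇒n≡quotient*m p^j∣z)) (*-monoˡ-∣ (p ^ j) p∣z'))
    N∣x'+y' : N ∣ quotient p^j∣x + quotient p^j∣y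
    N∣x'+y' = *-cancelʳ-∣ (p ^ j) {{m^n≢0 p j}} (subst (N * p ^ j ∣_) (begin
      x + y                                               ≡⟨ cong₂ _+_ (m∣n⇒n≡quotient*m p^j∣x) (m∣n⇒n≡quotient*m p^j∣y) ⟩
      quotient p^j∣x * p ^ j + quotient p^j∣y * p ^ j     ≡⟨ *-distribʳ-+ (p ^ j) (quotient p^j∣x) _ ⟨
      (quotient p^j∣x + quotient p^j∣y) * p ^ j           ∎) Np^j∣x+y)
      where open ≡-Reasoning
  ... | t , t≢0 , coprime , Np^[n-j]∣tx'+y' = t , t≢0 , subst (λ m → Coprime t m) (sym M≡Np^n) coprime ,
    subst₂ _∣_ Np^[n∸j]*p^j≡M (identity t (m∣n⇒n≡quotient*m p^j∣x) (m∣n⇒n≡quotient*m p^j∣y))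
      (*-monoˡ-∣ (p ^ j) Np^[n-j]∣tx'+y')
    where
    open ≡-Reasoning
    Np^[n∸j]*p^j≡M : N * p ^ suc (n ∸ suc j) * p ^ j ≡ M
    Np^[n∸j]*p^j≡M = begin
      N * p ^ suc (n ∸ suc j) * p ^ j ≡⟨ cong (λ e → N * p ^ e * p ^ j) (+-∸-assoc 1 j<n) ⟨
      N * p ^ (n ∸ j) * p ^ j         ≡⟨ *-assoc N (p ^ (n ∸ j)) (p ^ j) ⟩
      N * (p ^ (n ∸ j) * p ^ j)       ≡⟨ cong (N *_) (^-distribˡ-+-* p (n ∸ j) j) ⟨
      N * p ^ (n ∸ j + j)             ≡⟨ cong (λ e → N * p ^ e) (m∸n+n≡m (<⇒≤ j<n)) ⟩
      N * p ^ n                       ≡⟨ M≡Np^n ⟨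
      M                               ∎
    identity : ∀ t {x y x' y' q} → x ≡ x' * q → y ≡ y' * q → (t * x' + y') * q ≡ t * x + y
    identity t {x' = x'} {y'} {q} refl refl = regroup t x' y' q
      where
      regroup : ∀ t x' y' q → (t * x' + y') * q ≡ t * (x' * q) + y' * q
      regroup = solve-∀

  unit-multiple⇒≡ : ∀ {u u' w w'} → A u → A u' → B w → B w' →
    (∃ λ t → NonZero t × Coprime t M × M ∣ t * diff u u' + diff w w') → u ≡ u'
  unit-multiple⇒≡ {u} {u'} {w} {w'} u∈A u'∈A w∈B w'∈B (t , t≢0 , coprime , M∣tx+y) =
    dilated-sum-unique t {{t≢0}} coprime u∈A u'∈A w∈B w'∈B (∣-linear-diff⇒≋ t {u} {u'} {w} {w'} M∣tx+y)

  -- If neither difference were divisible, a unit multiple t of A would give two decompositions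
  -- of the same element of t A ⊕ B = ℤ_M.
  not-both-indivisible : ∀ {k u u' w w'} → k < n → A u → A u' → B w → B w' → N * p ^ k ∣ diff u u' + diff w w' →
    ¬ (p ^ suc k ∣ diff u u') → ¬ (p ^ suc k ∣ diff w w') → ⊥
  not-both-indivisible {k} {u} {u'} {w} {w'} k<n u∈A u'∈A w∈B w'∈B Np^k∣x+y P∤x P∤y =
    let j , j≤k , p^j∣x , p^1+j∤x = valuation p (diff u u') k P∤x
        p^j∣y , p^1+j∤y = exact-power-of-sum j≤k (∣-trans (n∣m*n N) Np^k∣x+y) P∤y p^j∣x p^1+j∤x
        u≡u' = unit-multiple⇒≡ u∈A u'∈A w∈B w'∈B (unit-multiple (≤-<-trans j≤k k<n) p^j∣x p^1+j∤x p^j∣y p^1+j∤y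
                 (∣-trans (*-monoʳ-∣ N (pow-mono-∣ p j≤k)) Np^k∣x+y))
    in P∤x (subst (λ v → p ^ suc k ∣ diff u v) u≡u' (subst (p ^ suc k ∣_) (sym (diff-self u)) (p^i∣M k<n)))

  separation : ∀ {k u u' w w'} → k < n → A u → A u' → B w → B w' → N * p ^ k ∣ diff u u' + diff w w' →
    p ^ suc k ∣ diff u u' ⊎ p ^ suc k ∣ diff w w'
  separation {k} {u} {u'} {w} {w'} k<n u∈A u'∈A w∈B w'∈B Np^k∣x+y
    with p ^ suc k ∣? diff u u' | p ^ suc k ∣? diff w w'
  ... | yes P∣x | _       = inj₁ P∣x
  ... | no  _   | yes P∣y = inj₂ P∣y
  ... | no  P∤x | no  P∤y = ⊥-elim (not-both-indivisible k<n u∈A u'∈A w∈B w'∈B Np^k∣x+y P∤x P∤y)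

module _ {p : ℕ} {R S : Rel ℕ 0ℓ} (1<p : 1 < p) (R-equiv : IsEquivalence R) (S-equiv : IsEquivalence S)
  (R∨S : ∀ {i j} → i < p → j < p → i ≢ j → R i j ⊎ S i j)
  (¬R∧S : ∀ {i j} → i < p → j < p → i ≢ j → R i j → S i j → ⊥) where
  private
    module R = IsEquivalence R-equiv
    module S = IsEquivalence S-equiv
    0<p = <-trans z<s 1<p

  spread : R 0 1 → ∀ ν → ν < p → R 0 ν
  spread R01 zero          _   = R.refl
  spread R01 (suc zero)    _   = R01
  spread R01 ν@(suc (suc _)) ν<p with R∨S 0<p ν<p (λ ())
  ... | inj₁ R0ν = R0ν
  ... | inj₂ S0ν with R∨S 1<p ν<p (λ ())
  ...   | inj₁ R1ν = R.trans R01 R1ν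
  ...   | inj₂ S1ν = ⊥-elim (¬R∧S 0<p 1<p (λ ()) R01 (S.trans S0ν (S.sym S1ν)))

dichotomy : ∀ {p} {R S : Rel ℕ 0ℓ} → 1 < p → IsEquivalence R → IsEquivalence S →
  (∀ {i j} → i < p → j < p → i ≢ j → R i j ⊎ S i j) →
  (∀ {i j} → i < p → j < p → i ≢ j → R i j → S i j → ⊥) →
  (∀ ν → ν < p → R 0 ν) ⊎ (∀ ν → ν < p → S 0 ν)
dichotomy 1<p R-equiv S-equiv R∨S ¬R∧S with R∨S (<-trans z<s 1<p) 1<p (λ ())
... | inj₁ R01 = inj₁ (spread 1<p R-equiv S-equiv R∨S ¬R∧S R01)
... | inj₂ S01 = inj₂ (spread 1<p S-equiv R-equiv (λ i<p j<p i≢j → Sum.swap (R∨S i<p j<p i≢j))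
                             (λ i<p j<p i≢j S R → ¬R∧S i<p j<p i≢j R S) S01)

module PairwiseDifferences {M : ℕ} .{{_ : NonZero M}} {p n α : ℕ} (pp : Prime p)
  (p^n∣M : p ^ n ∣ M) (p^1+n∤M : ¬ (p ^ suc n ∣ M)) (α<n : α < n)
  {A B : Fin M → Set} (A⊕B : DirectSum M A B) {z a b : ℕ → Fin M}
  (gcd-condition : ∀ ν ν' → ν < p → ν' < p → ν ≢ ν' → gcdM M (diff (z ν) (z ν')) * p ^ suc α ≡ M)
  (a∈A : ∀ ν → ν < p → A (a ν)) (b∈B : ∀ ν → ν < p → B (b ν))
  (a+b≡z : ∀ ν → ν < p → addM M (a ν) (b ν) ≡ toℕ (z ν))
  where
  open Residues M


  k = n ∸ α ∸ 1
  N = quotient p^n∣M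

  n∸α≡1+k : n ∸ α ≡ suc k
  n∸α≡1+k = +-∸-assoc 1 (m<n⇒0<n∸m α<n)

  k<n : k < n
  k<n = subst (_≤ n) n∸α≡1+k (m∸n≤m n α)

  M≡Np^n : M ≡ N * p ^ n
  M≡Np^n = m∣n⇒n≡quotient*m p^n∣M

  M≡Np^k*p^1+α : M ≡ N * p ^ k * p ^ suc α
  M≡Np^k*p^1+α = begin
    M                       ≡⟨ M≡Np^n ⟩
    N * p ^ n               ≡⟨ cong (λ e → N * p ^ e) (trans (sym (m∸n+n≡m (<⇒≤ α<n))) (cong (_+ α) n∸α≡1+k)) ⟩
    N * p ^ (suc k + α)     ≡⟨ cong (λ e → N * p ^ e) (+-suc k α) ⟨
    N * p ^ (k + suc α)     ≡⟨ cong (N *_) (^-distribˡ-+-* p k (suc α)) ⟩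
    N * (p ^ k * p ^ suc α) ≡⟨ *-assoc N (p ^ k) _ ⟨
    N * p ^ k * p ^ suc α   ∎
    where open ≡-Reasoning

  p∤N : ¬ (p ∣ N)
  p∤N p∣N = p^1+n∤M (subst (p ^ suc n ∣_) (sym M≡Np^n) (*-monoˡ-∣ (p ^ n) p∣N))

  open Separation A⊕B {p} {N} {n} pp M≡Np^n

  z-divisibility : ∀ {ν ν'} → ν < p → ν' < p → ν ≢ ν' →
    N * p ^ k ∣ diff (z ν) (z ν') × ¬ (p ^ suc k ∣ diff (z ν) (z ν'))
  z-divisibility ν<p ν'<p ν≢ν' =
    gcd-exact-part {p} {N} {k} {{prime⇒nonZero pp}} {{m^n≢0 p (suc α) {{prime⇒nonZero pp}}}}
      p∤N (p^i∣M k<n) M≡Np^k*p^1+α (gcd-condition _ _ ν<p ν'<p ν≢ν')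

  diff-a+diff-b≋diff-z : ∀ {ν ν'} → ν < p → ν' < p → diff (a ν) (a ν') + diff (b ν) (b ν') ≋ diff (z ν) (z ν')
  diff-a+diff-b≋diff-z {ν} {ν'} ν<p ν'<p = +-cancelʳ-≋ (toℕ (z ν')) (begin
    (dx + dy + toℕ (z ν')) % M                 ≡⟨ +-cong-≋ˡ (dx + dy) (a+b≋z ν'<p) ⟨
    (dx + dy + (toℕ (a ν') + toℕ (b ν'))) % M  ≡⟨ cong (_% M) (regroup dx dy (toℕ (a ν')) (toℕ (b ν'))) ⟩
    (dx + toℕ (a ν') + (dy + toℕ (b ν'))) % M  ≡⟨ +-cong-≋ (diff-+ (a ν) (a ν')) (diff-+ (b ν) (b ν')) ⟩
    (toℕ (a ν) + toℕ (b ν)) % M                ≡⟨ a+b≋z ν<p ⟩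
    toℕ (z ν) % M                              ≡⟨ diff-+ (z ν) (z ν') ⟨
    (diff (z ν) (z ν') + toℕ (z ν')) % M       ∎)
    where
    open ≡-Reasoning
    dx = diff (a ν) (a ν')
    dy = diff (b ν) (b ν')
    a+b≋z : ∀ {μ} → μ < p → toℕ (a μ) + toℕ (b μ) ≋ toℕ (z μ)
    a+b≋z {μ} μ<p = trans (sym (%-≋ _)) (cong (_% M) (a+b≡z μ μ<p))
    regroup : ∀ x y u w → x + y + (u + w) ≡ x + u + (y + w)
    regroup = solve-∀

  Np^k∣diff-a+diff-b : ∀ {ν ν'} → ν < p → ν' < p → ν ≢ ν' → N * p ^ k ∣ diff (a ν) (a ν') + diff (b ν) (b ν')
  Np^k∣diff-a+diff-b ν<p ν'<p ν≢ν' =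
    ∣-resp-≋ Np^k∣M (sym (diff-a+diff-b≋diff-z ν<p ν'<p)) (proj₁ (z-divisibility ν<p ν'<p ν≢ν'))
    where
    Np^k∣M : N * p ^ k ∣ M
    Np^k∣M = subst (N * p ^ k ∣_) (sym M≡Np^n) (*-monoʳ-∣ N (pow-mono-∣ p (<⇒≤ k<n)))

  _≈ᴬ_ _≈ᴮ_ : Rel ℕ 0ℓ
  _≈ᴬ_ = (λ x y → p ^ suc k ∣ diff x y) on a
  _≈ᴮ_ = (λ x y → p ^ suc k ∣ diff x y) on b

  ≈ᴬ-isEquivalence : IsEquivalence _≈ᴬ_
  ≈ᴬ-isEquivalence = On.isEquivalence a (∣-diff-isEquivalence (p^i∣M k<n))

  ≈ᴮ-isEquivalence : IsEquivalence _≈ᴮ_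
  ≈ᴮ-isEquivalence = On.isEquivalence b (∣-diff-isEquivalence (p^i∣M k<n))

  module ≈ᴬ = IsEquivalence ≈ᴬ-isEquivalence
  module ≈ᴮ = IsEquivalence ≈ᴮ-isEquivalence

  ≈ᴬ∨≈ᴮ : ∀ {ν ν'} → ν < p → ν' < p → ν ≢ ν' → ν ≈ᴬ ν' ⊎ ν ≈ᴮ ν'
  ≈ᴬ∨≈ᴮ ν<p ν'<p ν≢ν' =
    separation k<n (a∈A _ ν<p) (a∈A _ ν'<p) (b∈B _ ν<p) (b∈B _ ν'<p) (Np^k∣diff-a+diff-b ν<p ν'<p ν≢ν')

  ¬≈ᴬ∧≈ᴮ : ∀ {ν ν'} → ν < p → ν' < p → ν ≢ ν' → ν ≈ᴬ ν' → ν ≈ᴮ ν' → ⊥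
  ¬≈ᴬ∧≈ᴮ ν<p ν'<p ν≢ν' ν≈ᴬν' ν≈ᴮν' = proj₂ (z-divisibility ν<p ν'<p ν≢ν')
    (∣-resp-≋ (p^i∣M k<n) (diff-a+diff-b≋diff-z ν<p ν'<p) (∣m∣n⇒∣m+n ν≈ᴬν' ν≈ᴮν'))

  exact-complement : ∀ {ν ν' x y} → ν < p → ν' < p → ν ≢ ν' → x + y ≡ diff (a ν) (a ν') + diff (b ν) (b ν') →
    p ^ suc k ∣ x → ¬ (p ^ suc k ∣ y) → Exact M p k y
  exact-complement ν<p ν'<p ν≢ν' x+y≡ P∣x P∤y =
    ∣m+n∣m⇒∣n (subst (p ^ k ∣_) (sym x+y≡) (∣-trans (n∣m*n N) (Np^k∣diff-a+diff-b ν<p ν'<p ν≢ν')))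
              (∣-trans (n∣m*n p) P∣x) ,
    λ P∣gcd → P∤y (∣-trans P∣gcd (gcd[m,n]∣m _ M))

  Π-from-0 : ∀ (c : ℕ → Fin M) → (∀ ν → ν < p → p ^ suc k ∣ diff (c 0) (c ν)) →
    ∀ ν → 0 < ν → ν < p → c ν ∈Π[ c 0 , p ^ (n ∸ α) ]
  Π-from-0 c c₀≈c ν _ ν<p = subst (λ e → p ^ e ∣ diff (c 0) (c ν)) (sym n∸α≡1+k) (c₀≈c ν ν<p)

  a-side : (∀ ν → ν < p → 0 ≈ᴬ ν) →
    (∀ ν → 0 < ν → ν < p → a ν ∈Π[ a 0 , p ^ (n ∸ α) ]) ×
    (∀ ν ν' → ν < p → ν' < p → ν ≢ ν' → Exact M p (n ∸ α ∸ 1) (diff (b ν) (b ν')))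
  a-side 0≈ᴬ = Π-from-0 a 0≈ᴬ , λ ν ν' ν<p ν'<p ν≢ν' →
    let ν≈ᴬν' = ≈ᴬ.trans (≈ᴬ.sym (0≈ᴬ ν ν<p)) (0≈ᴬ ν' ν'<p)
    in exact-complement ν<p ν'<p ν≢ν' refl ν≈ᴬν' (¬≈ᴬ∧≈ᴮ ν<p ν'<p ν≢ν' ν≈ᴬν')

  b-side : (∀ ν → ν < p → 0 ≈ᴮ ν) →
    (∀ ν → 0 < ν → ν < p → b ν ∈Π[ b 0 , p ^ (n ∸ α) ]) ×
    (∀ ν ν' → ν < p → ν' < p → ν ≢ ν' → Exact M p (n ∸ α ∸ 1) (diff (a ν) (a ν')))
  b-side 0≈ᴮ = Π-from-0 b 0≈ᴮ , λ ν ν' ν<p ν'<p ν≢ν' →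
    let ν≈ᴮν' = ≈ᴮ.trans (≈ᴮ.sym (0≈ᴮ ν ν<p)) (0≈ᴮ ν' ν'<p)
    in exact-complement ν<p ν'<p ν≢ν' (+-comm (diff (b ν) (b ν')) _) ν≈ᴮν'
         (λ ν≈ᴬν' → ¬≈ᴬ∧≈ᴮ ν<p ν'<p ν≢ν' ν≈ᴬν' ν≈ᴮν')

lemma4p5 : (M : ℕ) .{{_ : NonZero M}} (p n α : ℕ) → Prime p →
    p ^ n ∣ M → ¬ (p ^ suc n ∣ M) → α < n →
    (A B : Fin M → Set) → DirectSum M A B →
    (z a b : ℕ → Fin M) →
    (∀ ν ν' → ν < p → ν' < p → ν ≢ ν' → gcdM M (diff (z ν) (z ν')) * p ^ suc α ≡ M) →
    (∀ ν → ν < p → A (a ν)) → (∀ ν → ν < p → B (b ν)) →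
    (∀ ν → ν < p → addM M (a ν) (b ν) ≡ toℕ (z ν)) →
    ((∀ ν → 0 < ν → ν < p → a ν ∈Π[ a 0 , p ^ (n ∸ α) ])
    × (∀ ν ν' → ν < p → ν' < p → ν ≢ ν' → Exact M p (n ∸ α ∸ 1) (diff (b ν) (b ν'))))
    ⊎
    ((∀ ν → 0 < ν → ν < p → b ν ∈Π[ b 0 , p ^ (n ∸ α) ])
    × (∀ ν ν' → ν < p → ν' < p → ν ≢ ν' → Exact M p (n ∸ α ∸ 1) (diff (a ν) (a ν'))))
lemma4p5 M p n α pp p^n∣M p^1+n∤M α<n A B A⊕B z a b gcd-condition a∈A b∈B a+b≡z =
  Sum.map a-side b-side (dichotomy (prime>1 pp) ≈ᴬ-isEquivalence ≈ᴮ-isEquivalence ≈ᴬ∨≈ᴮ ¬≈ᴬ∧≈ᴮ)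
  where open PairwiseDifferences pp p^n∣M p^1+n∤M α<n A⊕B gcd-condition a∈A b∈B a+b≡z
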